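{- Let $n\ge 8$, $k\ge 2$ and $t$ be integers with $2\le t\le n-3$, and let $T$ be a tree of order $n$ and diameter $n-t$. Then $\alpha_{k-reg}(T)=\max\{|D_1(T)|,|D_2(T)|\}$.
   Context: All graphs are finite, simple and undirected. For a graph $G$ and an integer $i\ge 0$, $D_i(G)$ denotes the set of vertices of degree $i$ in $G$. For an integer $k\ge 0$, a set $S\subseteq V(G)$ is $k$-independent if the induced subgraph $G[S]$ has maximum degree at most $k$. A regular $k$-independent set is a $k$-independent set $S$ with $S\subseteq D_i(G)$ for some $i$. The regular $k$-independence number $\alpha_{k-reg}(G)$ is the maximum cardinality of a regular $k$-independent set of $G$. -}

module Defs where

open import Data.Nat using (ℕ; zero; suc; _≤_; _≡ᵇ_)
open import Data.Fin using (Fin)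
open import Data.Fin.Subset using (Subset; _∈_; _∉_; _∩_; ∣_∣)
open import Data.Vec using (tabulate)
open import Data.Bool using (Bool)
open import Data.List using (List; []; _∷_)
open import Data.List.Relation.Unary.Unique.Propositional using (Unique)
open import Data.Product using (Σ; ∃; ∃-syntax; _×_)
open import Relation.Binary.PropositionalEquality using (_≡_)

record Graph (n : ℕ) : Set where
  field
    nbr    : Fin n → Subset n
    sym    : ∀ u v → v ∈ nbr u → u ∈ nbr v
    irrefl : ∀ v → v ∉ nbr v

module _ {n : ℕ} (G : Graph n) where
  open Graph G

  Adj : Fin n → Fin n → Set
  Adj u v = v ∈ nbr u

  degree : Fin n → ℕ
  degree v = ∣ nbr v ∣

  D : ℕ → Subset n
  D i = tabulate (λ v → degree v ≡ᵇ i)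

  data Walk : Fin n → Fin n → ℕ → Set where
    []  : ∀ {u} → Walk u u 0
    _∷_ : ∀ {u w v ℓ} → Adj u w → Walk w v ℓ → Walk u v (suc ℓ)

  verts : ∀ {u v ℓ} → Walk u v ℓ → List (Fin n)
  verts {u} []      = u ∷ []
  verts {u} (_ ∷ p) = u ∷ verts p

  tailVerts : ∀ {u v ℓ} → Walk u v ℓ → List (Fin n)
  tailVerts []      = []
  tailVerts (_ ∷ p) = verts p

  IsCycle : ∀ {u ℓ} → Walk u u ℓ → Set
  IsCycle {ℓ = ℓ} p = (3 ≤ ℓ) × Unique (tailVerts p)

  Connected : Set
  Connected = ∀ u v → ∃[ ℓ ] Walk u v ℓ

  Acyclic : Set
  Acyclic = ∀ u ℓ (p : Walk u u ℓ) → IsCycle p → Data.Empty.⊥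
    where import Data.Empty

  IsTree : Set
  IsTree = Connected × Acyclic

  Dist : Fin n → Fin n → ℕ → Set
  Dist u v d = Walk u v d × (∀ ℓ → Walk u v ℓ → d ≤ ℓ)

  Diameter : ℕ → Set
  Diameter d = (∃[ u ] ∃[ v ] Dist u v d) × (∀ u v e → Dist u v e → e ≤ d)

  KIndependent : ℕ → Subset n → Set
  KIndependent k S = ∀ v → v ∈ S → ∣ nbr v ∩ S ∣ ≤ k

  RegKIndependent : ℕ → Subset n → Set
  RegKIndependent k S = KIndependent k S × (∃[ i ] (∀ v → v ∈ S → v ∈ D i))

  RegKIndepNumber : ℕ → ℕ → Set
  RegKIndepNumber k m =
    (∃[ S ] (RegKIndependent k S × ∣ S ∣ ≡ m)) ×
    (∀ S → RegKIndependent k S → ∣ S ∣ ≤ m)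

-- In a tree of order n ≥ 2 every degree is positive and the degrees sum to 2(n − 1); the
-- pointwise inequality deg v + [deg v = 1] ≥ 2 + [deg v = i], valid for i ∉ {1, 2}, then sums
-- to |D_i| ≤ |D_1|. A regular k-independent set lies inside a single class D_i, while D_1 and
-- D_2 are k-independent once k ≥ 2, so the maximum is max{|D_1|, |D_2|}. The degree sum is
-- bounded by deleting, one at a time, a vertex of degree ≤ 1 in the remaining induced forest,
-- found as the end of a maximal path.
module Submission where

open import Defs
open import Data.Nat using (ℕ; _≤_; _∸_; _⊔_)
open import Data.Fin.Subset using (∣_∣)

open import Data.Bool using (Bool; true; false; _∧_)
open import Data.Bool.Properties using (∧-zeroʳ; ∧-identityʳ; T-≡)
open import Data.Empty using (⊥-elim)
open import Data.Fin using (Fin; zero; suc; punchIn)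
import Data.Fin.Properties as Finₚ
open import Data.Fin.Subset using (Subset; Nonempty; _∈_; _∩_; _⊆_; outside; ⊤; ⁅_⁆)
open import Data.Fin.Subset.Properties
  using (_∈?_; nonempty?; Empty-unique; ∣⊥∣≡0; ∈⊤; ∣⊤∣≡n; ∣p∩q∣≤∣p∣; ∣p∩q∣≤∣q∣; ∩-identityˡ; ∩-identityʳ; p⊆q⇒∣p∣≤∣q∣;
         x∈p∩q⁻; x∈⁅x⁆; ∣⁅x⁆∣≡1)
open import Data.List using (List; []; _∷_; _++_; _∷ʳ_)
import Data.List.Membership.Propositional as List
import Data.List.Membership.DecPropositional as DecList
open import Data.List.Membership.Propositional.Properties using (∈-++⁺ˡ)
open import Data.List.Relation.Unary.All.Properties using (++⁻ˡ; All¬⇒¬Any; ¬Any⇒All¬)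
open import Data.List.Relation.Unary.Any using (here; there)
open import Data.List.Relation.Unary.All using ([]; _∷_)
open import Data.List.Relation.Unary.AllPairs using ([]; _∷_)
open import Data.List.Relation.Unary.Unique.Propositional using (Unique)
import Data.List.Relation.Unary.Unique.Propositional.Properties as Unique
open import Data.Nat using (zero; suc; _+_; _*_; _<_; z≤n; s≤s; _≡ᵇ_)
open import Data.Nat.Properties
open import Data.Nat.Tactic.RingSolver using (solve-∀)
open import Algebra.Properties.CommutativeMonoid.Sum +-0-commutativeMonoid
  using (sum; sum-syntax; sum-cong-≗; ∑-distrib-+; sum-replicate-zero)
open import Data.Product using (Σ; ∃; ∃-syntax; _×_; _,_; proj₁; proj₂)
open import Data.Sum using (inj₁; inj₂)
open import Data.Vec using (_∷_; []; lookup; _[_]≔_)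
open import Data.Vec.Properties
  using ([]=⇒lookup; lookup⇒[]=; lookup∘update; lookup∘update′; lookup-zipWith;
         lookup-replicate; lookup∘tabulate; []≔-minimal)
open import Function using (_∘_; Equivalence)
open import Relation.Binary.PropositionalEquality
open import Relation.Nullary using (¬_; yes; no)
open import Relation.Nullary.Decidable using (_×-dec_; ¬?)

𝟙 : Bool → ℕ
𝟙 true  = 1
𝟙 false = 0

𝟙x*[c+𝟙y]≡𝟙x*c+𝟙[y∧x] : ∀ x y c → 𝟙 x * (c + 𝟙 y) ≡ 𝟙 x * c + 𝟙 (y ∧ x)
𝟙x*[c+𝟙y]≡𝟙x*c+𝟙[y∧x] true  y c rewrite ∧-identityʳ y =
  trans (+-identityʳ (c + 𝟙 y)) (cong (_+ 𝟙 y) (sym (+-identityʳ c)))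
𝟙x*[c+𝟙y]≡𝟙x*c+𝟙[y∧x] false y     c rewrite ∧-zeroʳ y = refl

𝟙≤1 : ∀ b → 𝟙 b ≤ 1
𝟙≤1 true  = ≤-refl
𝟙≤1 false = z≤n

𝟙[m≡ᵇn]≡0 : ∀ {m n} → ¬ m ≡ n → 𝟙 (m ≡ᵇ n) ≡ 0
𝟙[m≡ᵇn]≡0 {m} {n} m≢n with m ≡ᵇ n in eq
... | true  = ⊥-elim (m≢n (≡ᵇ⇒≡ m n (Equivalence.from T-≡ eq)))
... | false = refl

e+d+d+2≤2[2+m] : ∀ {e d m} → d ≤ 1 → e + 2 ≤ 2 * suc m → e + d + d + 2 ≤ 2 * suc (suc m)
e+d+d+2≤2[2+m] {e} {d} {m} d≤1 e+2≤2[1+m] = begin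
  e + d + d + 2        ≤⟨ +-monoˡ-≤ 2 (+-mono-≤ (+-monoʳ-≤ e d≤1) d≤1) ⟩
  e + 1 + 1 + 2        ≡⟨ shift e ⟩
  e + 2 + 2            ≤⟨ +-monoˡ-≤ 2 e+2≤2[1+m] ⟩
  2 * suc m + 2        ≡⟨ double-suc m ⟩
  2 * suc (suc m)      ∎
  where
  open ≤-Reasoning
  shift : ∀ e → e + 1 + 1 + 2 ≡ e + 2 + 2
  shift = solve-∀
  double-suc : ∀ m → 2 * suc m + 2 ≡ 2 * suc (suc m)
  double-suc = solve-∀

∑-mono-≤ : ∀ {n} {f g : Fin n → ℕ} → (∀ v → f v ≤ g v) → sum f ≤ sum g
∑-mono-≤ {zero}  f≤g = ≤-refl
∑-mono-≤ {suc n} f≤g = +-mono-≤ (f≤g zero) (∑-mono-≤ (f≤g ∘ suc))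

∑-const : ∀ n c → ∑[ _ < n ] c ≡ n * c
∑-const zero    c = refl
∑-const (suc n) c = cong (c +_) (∑-const n c)

∑-split : ∀ {n} (b : Fin n) {f g : Fin n → ℕ} c →
          (∀ v → ¬ v ≡ b → f v ≡ g v) → f b ≡ g b + c → sum f ≡ sum g + c
∑-split zero {f} {g} c off at = begin
  f zero + sum (f ∘ suc)        ≡⟨ cong₂ _+_ at (sum-cong-≗ (λ v → off (suc v) λ ())) ⟩
  g zero + c + sum (g ∘ suc)    ≡⟨ +-assoc (g zero) c _ ⟩
  g zero + (c + sum (g ∘ suc))  ≡⟨ cong (g zero +_) (+-comm c _) ⟩
  g zero + (sum (g ∘ suc) + c)  ≡⟨ +-assoc (g zero) _ c ⟨
  g zero + sum (g ∘ suc) + c    ∎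
  where open ≡-Reasoning
∑-split (suc b) {f} {g} c off at = begin
  f zero + sum (f ∘ suc)        ≡⟨ cong₂ _+_ (off zero λ ()) (∑-split b c off′ at) ⟩
  g zero + (sum (g ∘ suc) + c)  ≡⟨ +-assoc (g zero) _ c ⟨
  g zero + sum (g ∘ suc) + c    ∎
  where
  open ≡-Reasoning
  off′ : ∀ v → ¬ v ≡ b → f (suc v) ≡ g (suc v)
  off′ v v≢b = off (suc v) (v≢b ∘ Finₚ.suc-injective)

∣p∣≡∑𝟙 : ∀ {n} (p : Subset n) → ∣ p ∣ ≡ ∑[ v < n ] 𝟙 (lookup p v)
∣p∣≡∑𝟙 []          = refl
∣p∣≡∑𝟙 (true ∷ p)  = cong suc (∣p∣≡∑𝟙 p)
∣p∣≡∑𝟙 (false ∷ p) = ∣p∣≡∑𝟙 p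

∣q∩p∣≡∣q∩p[x]≔outside∣+𝟙 : ∀ {n} (q p : Subset n) {x} → x ∈ p →
                  ∣ q ∩ p ∣ ≡ ∣ q ∩ (p [ x ]≔ outside) ∣ + 𝟙 (lookup q x)
∣q∩p∣≡∣q∩p[x]≔outside∣+𝟙 q p {x} x∈p = begin
  ∣ q ∩ p ∣                                            ≡⟨ ∣p∣≡∑𝟙 (q ∩ p) ⟩
  sum (λ v → 𝟙 (lookup (q ∩ p) v))                     ≡⟨ ∑-split x _ off at ⟩
  sum (λ v → 𝟙 (lookup (q ∩ p′) v)) + 𝟙 (lookup q x)  ≡⟨ cong (_+ _) (∣p∣≡∑𝟙 (q ∩ p′)) ⟨
  ∣ q ∩ p′ ∣ + 𝟙 (lookup q x)                          ∎
  where
  open ≡-Reasoning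
  p′ = p [ x ]≔ outside
  off : ∀ v → ¬ v ≡ x → 𝟙 (lookup (q ∩ p) v) ≡ 𝟙 (lookup (q ∩ p′) v)
  off v v≢x rewrite lookup-zipWith _∧_ v q p | lookup-zipWith _∧_ v q p′
                  | lookup∘update′ v≢x p outside = refl
  at : 𝟙 (lookup (q ∩ p) x) ≡ 𝟙 (lookup (q ∩ p′) x) + 𝟙 (lookup q x)
  at rewrite lookup-zipWith _∧_ x q p | lookup-zipWith _∧_ x q p′
           | lookup∘update x p outside | []=⇒lookup x∈p with lookup q x
  ... | true  = refl
  ... | false = refl

∣p∣≡∣p[x]≔outside∣+1 : ∀ {n} (p : Subset n) {x} → x ∈ p → ∣ p ∣ ≡ ∣ p [ x ]≔ outside ∣ + 1
∣p∣≡∣p[x]≔outside∣+1 p {x} x∈p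
  with ∣q∩p∣≡∣q∩p[x]≔outside∣+𝟙 ⊤ p x∈p
... | eq rewrite ∩-identityˡ p | ∩-identityˡ (p [ x ]≔ outside) | lookup-replicate x true = eq

x∈p⇒1≤∣p∣ : ∀ {n} {p : Subset n} {x} → x ∈ p → 1 ≤ ∣ p ∣
x∈p⇒1≤∣p∣ {p = p} x∈p = subst (1 ≤_) (sym (∣p∣≡∣p[x]≔outside∣+1 p x∈p)) (m≤n+m 1 _)

∣p[x]≔outside∣<∣p∣ : ∀ {n} {p : Subset n} {x} → x ∈ p → ∣ p [ x ]≔ outside ∣ < ∣ p ∣
∣p[x]≔outside∣<∣p∣ {p = p} x∈p =
  subst (∣ p [ _ ]≔ outside ∣ <_) (trans (+-comm 1 _) (sym (∣p∣≡∣p[x]≔outside∣+1 p x∈p))) (n<1+n _)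

p⊆⁅x⁆⇒∣p∣≤1 : ∀ {n} {p : Subset n} {x} → p ⊆ ⁅ x ⁆ → ∣ p ∣ ≤ 1
p⊆⁅x⁆⇒∣p∣≤1 {x = x} p⊆⁅x⁆ = ≤-trans (p⊆q⇒∣p∣≤∣q∣ p⊆⁅x⁆) (≤-reflexive (∣⁅x⁆∣≡1 x))

∣p∣≡suc⇒Nonempty : ∀ {n} (p : Subset n) {m} → ∣ p ∣ ≡ suc m → Nonempty p
∣p∣≡suc⇒Nonempty {n} p ∣p∣≡1+m with nonempty? p
... | yes ne = ne
... | no  empty with () ← trans (sym ∣p∣≡1+m) (trans (cong ∣_∣ (Empty-unique empty)) (∣⊥∣≡0 n))

Unique-++⁻ˡ : ∀ {A : Set} (xs : List A) {ys} → Unique (xs ++ ys) → Unique xs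
Unique-++⁻ˡ []       _           = []
Unique-++⁻ˡ (x ∷ xs) (x∉ ∷ uniq) = ++⁻ˡ xs x∉ ∷ Unique-++⁻ˡ xs uniq

Unique-∷ʳ : ∀ {A : Set} {xs : List A} {x} → Unique xs → ¬ (x List.∈ xs) → Unique (xs ∷ʳ x)
Unique-∷ʳ uniq x∉xs = Unique.++⁺ uniq ([] ∷ []) λ where (x∈xs , here refl) → x∉xs x∈xs

module _ {n : ℕ} (G : Graph n) where
  open Graph G renaming (sym to nbr-sym)
  open DecList (Finₚ._≟_ {n}) using () renaming (_∈?_ to _∈ₗ?_)

  lookup-nbr-sym : ∀ u v → lookup (nbr u) v ≡ lookup (nbr v) u
  lookup-nbr-sym u v with lookup (nbr u) v in uv | lookup (nbr v) u in vu
  ... | true  | true  = refl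
  ... | false | false = refl
  ... | true  | false = trans (sym ([]=⇒lookup (nbr-sym u v (lookup⇒[]= v (nbr u) uv)))) vu
  ... | false | true  = trans (sym uv) ([]=⇒lookup (nbr-sym v u (lookup⇒[]= u (nbr v) vu)))

  lookup-nbr-irrefl : ∀ v → lookup (nbr v) v ≡ false
  lookup-nbr-irrefl v with lookup (nbr v) v in vv
  ... | true  = ⊥-elim (irrefl v (lookup⇒[]= v (nbr v) vv))
  ... | false = refl

  degreeIn : Subset n → Fin n → ℕ
  degreeIn W v = ∣ nbr v ∩ W ∣

  degreeIn-remove-self : ∀ W {b} → b ∈ W → degreeIn (W [ b ]≔ outside) b ≡ degreeIn W b
  degreeIn-remove-self W {b} b∈W = sym (begin
    ∣ nbr b ∩ W ∣                          ≡⟨ ∣q∩p∣≡∣q∩p[x]≔outside∣+𝟙 (nbr b) W b∈W ⟩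
    ∣ nbr b ∩ W′ ∣ + 𝟙 (lookup (nbr b) b)  ≡⟨ cong (λ x → ∣ nbr b ∩ W′ ∣ + 𝟙 x) (lookup-nbr-irrefl b) ⟩
    ∣ nbr b ∩ W′ ∣ + 0                     ≡⟨ +-identityʳ _ ⟩
    ∣ nbr b ∩ W′ ∣                         ∎)
    where
    open ≡-Reasoning
    W′ = W [ b ]≔ outside

  inducedDegreeSum : Subset n → ℕ
  inducedDegreeSum W = ∑[ v < n ] (𝟙 (lookup W v) * degreeIn W v)

  inducedDegreeSum-⊤ : inducedDegreeSum ⊤ ≡ ∑[ v < n ] degree G v
  inducedDegreeSum-⊤ = sum-cong-≗ λ v →
    trans (cong₂ (λ b c → 𝟙 b * c) (lookup-replicate v true) (cong ∣_∣ (∩-identityʳ (nbr v))))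
          (+-identityʳ _)

  inducedDegreeSum-empty : ∀ W → ∣ W ∣ ≡ 0 → inducedDegreeSum W ≡ 0
  inducedDegreeSum-empty W ∣W∣≡0 = trans (sum-cong-≗ term≡0) (sum-replicate-zero n)
    where
    term≡0 : ∀ v → 𝟙 (lookup W v) * degreeIn W v ≡ 0
    term≡0 v rewrite n≤0⇒n≡0 (subst (degreeIn W v ≤_) ∣W∣≡0 (∣p∩q∣≤∣q∣ (nbr v) W)) =
      *-zeroʳ (𝟙 (lookup W v))

  -- Removing b from W deletes the edges of G[W] at b, each counted from both ends.
  inducedDegreeSum-remove : ∀ W {b} → b ∈ W →
    inducedDegreeSum W ≡ inducedDegreeSum (W [ b ]≔ outside) + degreeIn W b + degreeIn W b
  inducedDegreeSum-remove W {b} b∈W = begin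
    inducedDegreeSum W                                              ≡⟨ ∑-split b d off at ⟩
    sum (λ v → term W′ v + 𝟙 (lookup (nbr b ∩ W′) v)) + d          ≡⟨ cong (_+ d) (∑-distrib-+ (term W′) _) ⟩
    inducedDegreeSum W′ + sum (λ v → 𝟙 (lookup (nbr b ∩ W′) v)) + d ≡⟨ cong (λ x → inducedDegreeSum W′ + x + d) ∑≡d ⟩
    inducedDegreeSum W′ + d + d                                     ∎
    where
    open ≡-Reasoning
    W′ = W [ b ]≔ outside
    d  = degreeIn W b
    term : Subset n → Fin n → ℕ
    term X v = 𝟙 (lookup X v) * degreeIn X v
    ∑≡d : sum (λ v → 𝟙 (lookup (nbr b ∩ W′) v)) ≡ d
    ∑≡d = trans (sym (∣p∣≡∑𝟙 (nbr b ∩ W′))) (degreeIn-remove-self W b∈W)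
    off : ∀ v → ¬ v ≡ b → term W v ≡ term W′ v + 𝟙 (lookup (nbr b ∩ W′) v)
    off v v≢b rewrite ∣q∩p∣≡∣q∩p[x]≔outside∣+𝟙 (nbr v) W b∈W | lookup-nbr-sym v b
                    | lookup-zipWith _∧_ v (nbr b) W′ | lookup∘update′ v≢b W outside
      = 𝟙x*[c+𝟙y]≡𝟙x*c+𝟙[y∧x] (lookup W v) (lookup (nbr b) v) _
    at : term W b ≡ term W′ b + 𝟙 (lookup (nbr b ∩ W′) b) + d
    at rewrite lookup-zipWith _∧_ b (nbr b) W′ | lookup∘update b W outside
             | []=⇒lookup b∈W | ∧-zeroʳ (lookup (nbr b) b) = +-identityʳ d

  walk⇒1≤degree : ∀ {u v ℓ} → Walk G u v ℓ → ¬ u ≡ v → 1 ≤ degree G u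
  walk⇒1≤degree []        u≢v = ⊥-elim (u≢v refl)
  walk⇒1≤degree (u~w ∷ _) _   = x∈p⇒1≤∣p∣ u~w

  snoc : ∀ {u v w ℓ} → Walk G u v ℓ → Adj G v w → Walk G u w (suc ℓ)
  snoc []      v~w = v~w ∷ []
  snoc (e ∷ p) v~w = e ∷ snoc p v~w

  verts-snoc : ∀ {u v w ℓ} (p : Walk G u v ℓ) (v~w : Adj G v w) → verts G (snoc p v~w) ≡ verts G p ∷ʳ w
  verts-snoc []      v~w = refl
  verts-snoc (e ∷ p) v~w = cong (_ ∷_) (verts-snoc p v~w)

  walk-prefix : ∀ {s z ℓ} (q : Walk G s z ℓ) {c} → c List.∈ verts G q →
    ∃[ j ] Σ (Walk G s c j) λ q₁ → ∃ λ rest → verts G q₁ ++ rest ≡ verts G q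
  walk-prefix []      (here refl) = 0 , [] , [] , refl
  walk-prefix (e ∷ q) (here refl) = 0 , [] , verts G q , refl
  walk-prefix (e ∷ q) (there c∈q) with walk-prefix q c∈q
  ... | j , q₁ , rest , eq = suc j , e ∷ q₁ , rest , cong (_ ∷_) eq

  path+two-edges⇒cycle : ∀ {a s c j} (a~s : Adj G a s) (q : Walk G s c j) (c~a : Adj G c a) →
    Unique (verts G q) → ¬ (a List.∈ verts G q) → ¬ c ≡ s → IsCycle G (a~s ∷ snoc q c~a)
  path+two-edges⇒cycle a~s []      c~a uniq a∉q c≢s = ⊥-elim (c≢s refl)
  path+two-edges⇒cycle a~s (e ∷ q) c~a uniq a∉q c≢s =
    s≤s (s≤s (s≤s z≤n)) , subst Unique (sym (verts-snoc (e ∷ q) c~a)) (Unique-∷ʳ uniq a∉q)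

  acyclic⇒path-nbr≡next : Acyclic G → ∀ {a s z ℓ c} (a~s : Adj G a s) (q : Walk G s z ℓ) →
    Unique (verts G (a~s ∷ q)) → Adj G a c → c List.∈ verts G q → c ≡ s
  acyclic⇒path-nbr≡next acyc {a} {s} {c = c} a~s q (a∉q ∷ uniq) a~c c∈q with c Finₚ.≟ s
  ... | yes c≡s = c≡s
  ... | no  c≢s with walk-prefix q c∈q
  ...   | _ , q₁ , _ , q₁++rest≡q =
    ⊥-elim (acyc a _ (a~s ∷ snoc q₁ c~a)
             (path+two-edges⇒cycle a~s q₁ c~a uniq₁ (All¬⇒¬Any a∉q ∘ a∈q) c≢s))
    where
    c~a = nbr-sym a c a~c
    uniq₁ = Unique-++⁻ˡ (verts G q₁) (subst Unique (sym q₁++rest≡q) uniq)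
    a∈q : a List.∈ verts G q₁ → a List.∈ verts G q
    a∈q a∈q₁ = subst (a List.∈_) q₁++rest≡q (∈-++⁺ˡ a∈q₁)

  acyclic⇒path-start-degreeIn≤1 : Acyclic G → ∀ W {a z ℓ} (p : Walk G a z ℓ) → Unique (verts G p) →
    (∀ c → c ∈ nbr a ∩ W → c List.∈ verts G p) → degreeIn W a ≤ 1
  acyclic⇒path-start-degreeIn≤1 acyc W {a} [] _ nbrs-on-p = p⊆⁅x⁆⇒∣p∣≤1 nbrs⊆⁅a⁆
    where
    nbrs⊆⁅a⁆ : nbr a ∩ W ⊆ ⁅ a ⁆
    nbrs⊆⁅a⁆ {c} c∈ with nbrs-on-p c c∈
    ... | here refl = x∈⁅x⁆ a
  acyclic⇒path-start-degreeIn≤1 acyc W {a} (_∷_ {w = s} a~s q) uniq nbrs-on-p = p⊆⁅x⁆⇒∣p∣≤1 nbrs⊆⁅s⁆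
    where
    nbrs⊆⁅s⁆ : nbr a ∩ W ⊆ ⁅ s ⁆
    nbrs⊆⁅s⁆ {c} c∈ with proj₁ (x∈p∩q⁻ (nbr a) W c∈) | nbrs-on-p c c∈
    ... | a~c | here refl = ⊥-elim (irrefl a a~c)
    ... | a~c | there c∈q =
      subst (_∈ ⁅ s ⁆) (sym (acyclic⇒path-nbr≡next acyc a~s q uniq a~c c∈q)) (x∈⁅x⁆ s)

  -- Grow a path backwards inside W until its start has no W-neighbour off the path;
  -- R contains every vertex of W off the path, so ∣ R ∣ bounds the number of further steps.
  acyclic⇒extend-path : Acyclic G → ∀ W fuel (R : Subset n) → ∣ R ∣ < fuel →
    ∀ {a z ℓ} (p : Walk G a z ℓ) → Unique (verts G p) → a ∈ W →
    (∀ x → x ∈ W → ¬ (x List.∈ verts G p) → x ∈ R) → ∃[ b ] b ∈ W × degreeIn W b ≤ 1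
  acyclic⇒extend-path acyc W (suc fuel) R (s≤s ∣R∣≤fuel) {a} p uniq a∈W off-p⊆R
    with Finₚ.any? (λ c → (c ∈? nbr a ∩ W) ×-dec ¬? (c ∈ₗ? verts G p))
  ... | yes (c , c∈ , c∉p) =
    acyclic⇒extend-path acyc W fuel (R [ c ]≔ outside) (≤-trans (∣p[x]≔outside∣<∣p∣ c∈R) ∣R∣≤fuel)
      (c~a ∷ p) (¬Any⇒All¬ _ c∉p ∷ uniq) c∈W off-p′⊆R-c
    where
    c~a = nbr-sym a c (proj₁ (x∈p∩q⁻ (nbr a) W c∈))
    c∈W = proj₂ (x∈p∩q⁻ (nbr a) W c∈)
    c∈R = off-p⊆R c c∈W c∉p
    off-p′⊆R-c : ∀ x → x ∈ W → ¬ (x List.∈ verts G (c~a ∷ p)) → x ∈ R [ c ]≔ outside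
    off-p′⊆R-c x x∈W x∉p′ = []≔-minimal R x c (x∉p′ ∘ here) (off-p⊆R x x∈W (x∉p′ ∘ there))
  ... | no stuck = a , a∈W , acyclic⇒path-start-degreeIn≤1 acyc W p uniq nbrs-on-p
    where
    nbrs-on-p : ∀ c → c ∈ nbr a ∩ W → c List.∈ verts G p
    nbrs-on-p c c∈ with c ∈ₗ? verts G p
    ... | yes c∈p = c∈p
    ... | no  c∉p = ⊥-elim (stuck (c , c∈ , c∉p))

  acyclic⇒∃degreeIn≤1 : Acyclic G → ∀ W {x} → x ∈ W → ∃[ b ] b ∈ W × degreeIn W b ≤ 1
  acyclic⇒∃degreeIn≤1 acyc W {x} x∈W =
    acyclic⇒extend-path acyc W (suc n) ⊤ (s≤s (≤-reflexive (∣⊤∣≡n n))) {x} [] ([] ∷ []) x∈W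
      (λ _ _ _ → ∈⊤)

  acyclic⇒inducedDegreeSum+2≤2∣W∣ : Acyclic G → ∀ m W → ∣ W ∣ ≡ suc m → inducedDegreeSum W + 2 ≤ 2 * suc m
  acyclic⇒inducedDegreeSum+2≤2∣W∣ acyc m W ∣W∣≡1+m
    with acyclic⇒∃degreeIn≤1 acyc W (proj₂ (∣p∣≡suc⇒Nonempty W ∣W∣≡1+m))
  ... | b , b∈W , d≤1 = begin
    inducedDegreeSum W + 2            ≡⟨ cong (_+ 2) (inducedDegreeSum-remove W b∈W) ⟩
    inducedDegreeSum W′ + d + d + 2   ≤⟨ bound m ∣W′∣≡m ⟩
    2 * suc m                         ∎
    where
    open ≤-Reasoning
    W′ = W [ b ]≔ outside
    d  = degreeIn W b
    ∣W′∣≡m : ∣ W′ ∣ ≡ m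
    ∣W′∣≡m = suc-injective (trans (+-comm 1 _) (trans (sym (∣p∣≡∣p[x]≔outside∣+1 W b∈W)) ∣W∣≡1+m))
    bound : ∀ m → ∣ W′ ∣ ≡ m → inducedDegreeSum W′ + d + d + 2 ≤ 2 * suc m
    bound zero ∣W′∣≡0
      rewrite inducedDegreeSum-empty W′ ∣W′∣≡0
            | n≤0⇒n≡0 (≤-trans (≤-reflexive (sym (degreeIn-remove-self W b∈W)))
                               (subst (degreeIn W′ b ≤_) ∣W′∣≡0 (∣p∩q∣≤∣q∣ (nbr b) W′))) = ≤-refl
    bound (suc m′) ∣W′∣≡1+m′ =
      e+d+d+2≤2[2+m] d≤1 (acyclic⇒inducedDegreeSum+2≤2∣W∣ acyc m′ W′ ∣W′∣≡1+m′)

module _ {n : ℕ} (G : Graph n) where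

  ∈D⇒degree≡ : ∀ {i v} → v ∈ D G i → degree G v ≡ i
  ∈D⇒degree≡ {i} {v} v∈Dᵢ = ≡ᵇ⇒≡ (degree G v) i (Equivalence.from T-≡ degree≡ᵇi)
    where
    degree≡ᵇi : (degree G v ≡ᵇ i) ≡ true
    degree≡ᵇi = trans (sym (lookup∘tabulate _ v)) ([]=⇒lookup v∈Dᵢ)

  ∣D∣≡∑𝟙 : ∀ i → ∣ D G i ∣ ≡ ∑[ v < n ] 𝟙 (degree G v ≡ᵇ i)
  ∣D∣≡∑𝟙 i = trans (∣p∣≡∑𝟙 (D G i)) (sum-cong-≗ (cong 𝟙 ∘ lookup∘tabulate (λ v → degree G v ≡ᵇ i)))

  D-regKIndependent : ∀ {i k} → i ≤ k → RegKIndependent G k (D G i)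
  D-regKIndependent {i} i≤k =
    (λ v v∈Dᵢ → ≤-trans (∣p∩q∣≤∣p∣ (Graph.nbr G v) (D G i)) (≤-trans (≤-reflexive (∈D⇒degree≡ v∈Dᵢ)) i≤k)) ,
    i , λ _ v∈Dᵢ → v∈Dᵢ

  regKIndepNumber-largest-D : ∀ {k j m} → j ≤ k → ∣ D G j ∣ ≡ m → (∀ i → ∣ D G i ∣ ≤ m) → RegKIndepNumber G k m
  regKIndepNumber-largest-D {j = j} j≤k ∣Dⱼ∣≡m ∣D∣≤m =
    (D G j , D-regKIndependent j≤k , ∣Dⱼ∣≡m) ,
    λ S (_ , i , S⊆Dᵢ) → ≤-trans (p⊆q⇒∣p∣≤∣q∣ (S⊆Dᵢ _)) (∣D∣≤m i)

connected⇒1≤degree : ∀ {n} (G : Graph (suc (suc n))) → Connected G → ∀ v → 1 ≤ degree G v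
connected⇒1≤degree G conn v =
  walk⇒1≤degree G (proj₂ (conn v (punchIn v zero))) (Finₚ.punchInᵢ≢i v zero ∘ sym)

2+𝟙[d≡i]≤d+𝟙[d≡1] : ∀ d i → ¬ i ≡ 1 → ¬ i ≡ 2 → 1 ≤ d → 2 + 𝟙 (d ≡ᵇ i) ≤ d + 𝟙 (d ≡ᵇ 1)
2+𝟙[d≡i]≤d+𝟙[d≡1] 1 i i≢1 _ _ rewrite 𝟙[m≡ᵇn]≡0 (i≢1 ∘ sym) = ≤-refl
2+𝟙[d≡i]≤d+𝟙[d≡1] 2 i _ i≢2 _ rewrite 𝟙[m≡ᵇn]≡0 (i≢2 ∘ sym) = ≤-refl
2+𝟙[d≡i]≤d+𝟙[d≡1] (suc (suc (suc d))) i _ _ _ = ≤-trans (s≤s (s≤s (𝟙≤1 _))) (s≤s (s≤s (s≤s z≤n)))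

acyclic⇒∣Dᵢ∣≤∣D₁∣ : ∀ {n} (G : Graph (suc n)) → Acyclic G → (∀ v → 1 ≤ degree G v) →
  ∀ i → ¬ i ≡ 1 → ¬ i ≡ 2 → ∣ D G i ∣ ≤ ∣ D G 1 ∣
acyclic⇒∣Dᵢ∣≤∣D₁∣ {n} G acyc 1≤deg i i≢1 i≢2 =
  ≤-trans (m≤n+m _ 2) (+-cancelˡ-≤ ∑deg _ _ (begin
    ∑deg + (2 + ∣ D G i ∣)                          ≡⟨ +-assoc ∑deg 2 _ ⟨
    ∑deg + 2 + ∣ D G i ∣                            ≤⟨ +-monoˡ-≤ _ ∑deg+2≤2[1+n] ⟩
    2 * suc n + ∣ D G i ∣                           ≡⟨ cong₂ _+_ (trans (*-comm 2 (suc n)) (sym (∑-const (suc n) 2))) (∣D∣≡∑𝟙 G i) ⟩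
    ∑[ v < suc n ] 2 + ∑[ v < suc n ] 𝟙 (degree G v ≡ᵇ i)  ≡⟨ ∑-distrib-+ (λ _ → 2) (λ v → 𝟙 (degree G v ≡ᵇ i)) ⟨
    ∑[ v < suc n ] (2 + 𝟙 (degree G v ≡ᵇ i))        ≤⟨ ∑-mono-≤ (λ v → 2+𝟙[d≡i]≤d+𝟙[d≡1] (degree G v) i i≢1 i≢2 (1≤deg v)) ⟩
    ∑[ v < suc n ] (degree G v + 𝟙 (degree G v ≡ᵇ 1))  ≡⟨ ∑-distrib-+ (degree G) (λ v → 𝟙 (degree G v ≡ᵇ 1)) ⟩
    ∑deg + ∑[ v < suc n ] 𝟙 (degree G v ≡ᵇ 1)       ≡⟨ cong (∑deg +_) (∣D∣≡∑𝟙 G 1) ⟨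
    ∑deg + ∣ D G 1 ∣                                 ∎))
  where
  open ≤-Reasoning
  ∑deg = ∑[ v < suc n ] degree G v
  ∑deg+2≤2[1+n] : ∑deg + 2 ≤ 2 * suc n
  ∑deg+2≤2[1+n] = subst (λ x → x + 2 ≤ 2 * suc n) (inducedDegreeSum-⊤ G)
    (acyclic⇒inducedDegreeSum+2≤2∣W∣ G acyc n ⊤ (∣⊤∣≡n (suc n)))

tree⇒∣Dᵢ∣≤∣D₁∣⊔∣D₂∣ : ∀ {n} (T : Graph (suc (suc n))) → IsTree T → ∀ i → ∣ D T i ∣ ≤ ∣ D T 1 ∣ ⊔ ∣ D T 2 ∣
tree⇒∣Dᵢ∣≤∣D₁∣⊔∣D₂∣ T (connected , acyclic) i with i ≟ 1 | i ≟ 2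
... | yes refl | _        = m≤m⊔n _ _
... | no _     | yes refl = m≤n⊔m _ _
... | no i≢1   | no i≢2   =
  ≤-trans (acyclic⇒∣Dᵢ∣≤∣D₁∣ T acyclic (connected⇒1≤degree T connected) i i≢1 i≢2) (m≤m⊔n _ _)

lemma3p3 : (n k t : ℕ) (T : Graph n) → 8 ≤ n → 2 ≤ k → 2 ≤ t → t ≤ n ∸ 3 →
    IsTree T → Diameter T (n ∸ t) →
    RegKIndepNumber T k (∣ D T 1 ∣ ⊔ ∣ D T 2 ∣)
lemma3p3 (suc (suc n)) k t T (s≤s (s≤s _)) 2≤k _ _ tree _ with ⊔-sel ∣ D T 1 ∣ ∣ D T 2 ∣
... | inj₁ ⊔≡∣D₁∣ =
  regKIndepNumber-largest-D T (≤-trans (s≤s z≤n) 2≤k) (sym ⊔≡∣D₁∣) (tree⇒∣Dᵢ∣≤∣D₁∣⊔∣D₂∣ T tree)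
... | inj₂ ⊔≡∣D₂∣ =
  regKIndepNumber-largest-D T 2≤k (sym ⊔≡∣D₂∣) (tree⇒∣Dᵢ∣≤∣D₁∣⊔∣D₂∣ T tree)
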